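{- Let $L$ be a propositional language with propositional letters, the unary connective $\neg$, and a set $B$ of binary connectives. Let $f$ be a counting function on $L$ and $g$ an acceptable inductively defined function from $L$ to $L$. Then: (i) for every propositional letter $p_i$, $f(g(p_i))$ is a constant (a natural number); (ii) $f(g(\neg\phi))$ is a linear expression in $f(g(\phi))$: there exist natural numbers $c,d$ (depending only on $f$ and $g$) such that $f(g(\neg\phi)) = c + d\cdot f(g(\phi))$ for every formula $\phi$; (iii) for each $\Box\in B$, $f(g(\phi_1\,\Box\,\phi_2))$ is a linear expression in $f(g(\phi_1))$ and $f(g(\phi_2))$: there exist natural numbers $c,d_1,d_2$ (depending only on $f$, $g$ and $\Box$) such that $f(g(\phi_1\,\Box\,\phi_2)) = c + d_1\cdot f(g(\phi_1)) + d_2\cdot f(g(\phi_2))$ for all formulas $\phi_1,\phi_2$.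
   Context: A counting function on $L$ is a function $f$ from formulas of $L$ to $\mathbb{N}$ defined inductively by: $f(p_i)=c_i$ for each propositional letter $p_i$, with $c_i\in\mathbb{N}$; $f(\neg\phi)=a+b\cdot f(\phi)$ with fixed $a,b\in\mathbb{N}$; and for each binary connective $\Box\in B$, $f(\phi\,\Box\,\psi)=a_\Box+b_\Box\cdot f(\phi)+c_\Box\cdot f(\psi)$ with fixed $a_\Box,b_\Box,c_\Box\in\mathbb{N}$. For formulas $\chi,\chi_1,\chi_2,\psi$ and propositional letters $s,s_1,s_2$, $[\chi/s]\,\psi$ denotes the result of replacing every occurrence of $s$ in $\psi$ by $\chi$, and $[\chi_1/s_1,\chi_2/s_2]\,\psi$ the result of simultaneously replacing $s_1$ by $\chi_1$ and $s_2$ by $\chi_2$. An inductively defined function $g$ from $L$ to $L$ is acceptable if its definition can be written as: $g(p_i)=\phi_i$ (a fixed formula) for each propositional letter $p_i$; $g(\neg\phi)=[g(\phi)/s]\,\psi$ for a fixed formula $\psi$ and propositional letter $s$; and for each $\Box\in B$, $g(\phi_1\,\Box\,\phi_2)=[g(\phi_1)/s_1, g(\phi_2)/s_2]\,\psi_\Box$ for a fixed formula $\psi_\Box$ and propositional letters $s_1,s_2$. -}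

module Defs where

open import Data.Nat using (ℕ; _+_; _*_; _≟_)
open import Relation.Nullary using (yes; no)

data Formula (B : Set) : Set where
  var : ℕ → Formula B
  neg : Formula B → Formula B
  bin : B → Formula B → Formula B → Formula B

record CountingParams (B : Set) : Set where
  field
    cvar : ℕ → ℕ
    a b  : ℕ
    aB bB cB : B → ℕ

count : {B : Set} → CountingParams B → Formula B → ℕ
count P (var i) = CountingParams.cvar P i
count P (neg φ) = CountingParams.a P + CountingParams.b P * count P φ
count P (bin □ φ ψ) =
  CountingParams.aB P □ + CountingParams.bB P □ * count P φ + CountingParams.cB P □ * count P ψ

subst1 : {B : Set} → Formula B → ℕ → Formula B → Formula B
subst1 χ s (var i) with i ≟ s
... | yes _ = χ
... | no _  = var i
subst1 χ s (neg ψ) = neg (subst1 χ s ψ)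
subst1 χ s (bin □ ψ₁ ψ₂) = bin □ (subst1 χ s ψ₁) (subst1 χ s ψ₂)

-- [χ₁/s₁, χ₂/s₂] ψ : simultaneous replacement (s₁ takes precedence if s₁ = s₂).
subst2 : {B : Set} → Formula B → ℕ → Formula B → ℕ → Formula B → Formula B
subst2 χ₁ s₁ χ₂ s₂ (var i) with i ≟ s₁
... | yes _ = χ₁
... | no _ with i ≟ s₂
...   | yes _ = χ₂
...   | no _  = var i
subst2 χ₁ s₁ χ₂ s₂ (neg ψ) = neg (subst2 χ₁ s₁ χ₂ s₂ ψ)
subst2 χ₁ s₁ χ₂ s₂ (bin □ ψ₁ ψ₂) =
  bin □ (subst2 χ₁ s₁ χ₂ s₂ ψ₁) (subst2 χ₁ s₁ χ₂ s₂ ψ₂)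

record AcceptableParams (B : Set) : Set where
  field
    φvar : ℕ → Formula B
    ψneg : Formula B
    sneg : ℕ
    ψbin : B → Formula B
    s₁ s₂ : B → ℕ

acc : {B : Set} → AcceptableParams B → Formula B → Formula B
acc G (var i) = AcceptableParams.φvar G i
acc G (neg φ) = subst1 (acc G φ) (AcceptableParams.sneg G) (AcceptableParams.ψneg G)
acc G (bin □ φ₁ φ₂) =
  subst2 (acc G φ₁) (AcceptableParams.s₁ G □) (acc G φ₂) (AcceptableParams.s₂ G □)
         (AcceptableParams.ψbin G □)

module Submission where

-- A substitution instance [χ₁/s₁, χ₂/s₂] ψ is built from the letters of ψ and from
-- χ₁, χ₂ by the connectives, and a counting function sends each connective to an
-- affine map. Composites of affine maps being affine, f([χ₁/s₁, χ₂/s₂] ψ) is an affine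
-- function of f(χ₁) and f(χ₂) whose coefficients depend on ψ only. Instantiating χⱼ by
-- g(φⱼ) gives (iii), and (ii) since [χ/s] ψ = [χ/s, χ/s] ψ; (i) holds trivially.

open import Defs
open import Data.Nat using (ℕ; _+_; _*_; _≟_)
open import Data.Nat.Tactic.RingSolver using (solve-∀)
open import Data.Product using (_×_; ∃-syntax; _,_)
open import Relation.Binary.PropositionalEquality using (_≡_; refl; cong; cong₂; trans)
open import Relation.Nullary using (yes; no; contradiction)

affine-∘-affine : ∀ a b c d₁ d₂ x y →
  a + b * (c + d₁ * x + d₂ * y) ≡ (a + b * c) + (b * d₁) * x + (b * d₂) * y
affine-∘-affine = solve-∀

affine₂-∘-affine : ∀ a b c c₁ d₁ e₁ c₂ d₂ e₂ x y →
  a + b * (c₁ + d₁ * x + e₁ * y) + c * (c₂ + d₂ * x + e₂ * y)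
    ≡ (a + b * c₁ + c * c₂) + (b * d₁ + c * d₂) * x + (b * e₁ + c * e₂) * y
affine₂-∘-affine = solve-∀

affine-const : ∀ k x y → k ≡ k + 0 * x + 0 * y
affine-const = solve-∀

affine-proj₁ : ∀ x y → x ≡ 0 + 1 * x + 0 * y
affine-proj₁ = solve-∀

affine-proj₂ : ∀ x y → y ≡ 0 + 0 * x + 1 * y
affine-proj₂ = solve-∀

affine-diagonal : ∀ c d₁ d₂ x → c + d₁ * x + d₂ * x ≡ c + (d₁ + d₂) * x
affine-diagonal = solve-∀

subst1≡subst2 : {B : Set} (χ : Formula B) (s : ℕ) (ψ : Formula B) →
  subst1 χ s ψ ≡ subst2 χ s χ s ψ
subst1≡subst2 χ s (var i) with i ≟ s
... | yes _ = refl
... | no i≢s with i ≟ s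
...   | yes i≡s = contradiction i≡s i≢s
...   | no _    = refl
subst1≡subst2 χ s (neg ψ) = cong neg (subst1≡subst2 χ s ψ)
subst1≡subst2 χ s (bin □ ψ₁ ψ₂) =
  cong₂ (bin □) (subst1≡subst2 χ s ψ₁) (subst1≡subst2 χ s ψ₂)

module _ {B : Set} (F : CountingParams B) where
  open CountingParams F

  record CountAffine₁ (h : Formula B → Formula B) : Set where
    constructor countAffine₁
    field
      c d : ℕ
      count-≡ : (χ : Formula B) → count F (h χ) ≡ c + d * count F χ

  record CountAffine₂ (h : Formula B → Formula B → Formula B) : Set where
    constructor countAffine₂
    field
      c d₁ d₂ : ℕ
      count-≡ : (χ₁ χ₂ : Formula B) →
        count F (h χ₁ χ₂) ≡ c + d₁ * count F χ₁ + d₂ * count F χ₂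

  countAffine₂-const : ∀ ψ → CountAffine₂ (λ _ _ → ψ)
  countAffine₂-const ψ = countAffine₂ (count F ψ) 0 0 λ χ₁ χ₂ →
    affine-const (count F ψ) (count F χ₁) (count F χ₂)

  countAffine₂-proj₁ : CountAffine₂ (λ χ₁ _ → χ₁)
  countAffine₂-proj₁ = countAffine₂ 0 1 0 λ χ₁ χ₂ →
    affine-proj₁ (count F χ₁) (count F χ₂)

  countAffine₂-proj₂ : CountAffine₂ (λ _ χ₂ → χ₂)
  countAffine₂-proj₂ = countAffine₂ 0 0 1 λ χ₁ χ₂ →
    affine-proj₂ (count F χ₁) (count F χ₂)

  countAffine₂-neg : ∀ {h} → CountAffine₂ h → CountAffine₂ (λ χ₁ χ₂ → neg (h χ₁ χ₂))
  countAffine₂-neg (countAffine₂ c d₁ d₂ eq) =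
    countAffine₂ (a + b * c) (b * d₁) (b * d₂) λ χ₁ χ₂ →
      trans (cong (λ n → a + b * n) (eq χ₁ χ₂))
            (affine-∘-affine a b c d₁ d₂ (count F χ₁) (count F χ₂))

  countAffine₂-bin : ∀ □ {h k} → CountAffine₂ h → CountAffine₂ k →
    CountAffine₂ (λ χ₁ χ₂ → bin □ (h χ₁ χ₂) (k χ₁ χ₂))
  countAffine₂-bin □ (countAffine₂ c₁ d₁ e₁ eq₁) (countAffine₂ c₂ d₂ e₂ eq₂) =
    countAffine₂ (aB □ + bB □ * c₁ + cB □ * c₂)
                 (bB □ * d₁ + cB □ * d₂)
                 (bB □ * e₁ + cB □ * e₂) λ χ₁ χ₂ →
      trans (cong₂ (λ m n → aB □ + bB □ * m + cB □ * n) (eq₁ χ₁ χ₂) (eq₂ χ₁ χ₂))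
            (affine₂-∘-affine (aB □) (bB □) (cB □) c₁ d₁ e₁ c₂ d₂ e₂
                              (count F χ₁) (count F χ₂))

  countAffine₂-subst2 : ∀ s₁ s₂ ψ → CountAffine₂ (λ χ₁ χ₂ → subst2 χ₁ s₁ χ₂ s₂ ψ)
  countAffine₂-subst2 s₁ s₂ (var i) with i ≟ s₁
  ... | yes _ = countAffine₂-proj₁
  ... | no _ with i ≟ s₂
  ...   | yes _ = countAffine₂-proj₂
  ...   | no _  = countAffine₂-const (var i)
  countAffine₂-subst2 s₁ s₂ (neg ψ) = countAffine₂-neg (countAffine₂-subst2 s₁ s₂ ψ)
  countAffine₂-subst2 s₁ s₂ (bin □ ψ₁ ψ₂) =
    countAffine₂-bin □ (countAffine₂-subst2 s₁ s₂ ψ₁) (countAffine₂-subst2 s₁ s₂ ψ₂)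

  countAffine₁-subst1 : ∀ s ψ → CountAffine₁ (λ χ → subst1 χ s ψ)
  countAffine₁-subst1 s ψ with countAffine₂-subst2 s s ψ
  ... | countAffine₂ c d₁ d₂ eq = countAffine₁ c (d₁ + d₂) λ χ →
    trans (cong (count F) (subst1≡subst2 χ s ψ))
          (trans (eq χ χ) (affine-diagonal c d₁ d₂ (count F χ)))

lemma2 : {B : Set} (F : CountingParams B) (G : AcceptableParams B) →
    ((i : ℕ) → ∃[ k ] count F (acc G (var i)) ≡ k)
    × (∃[ c ] ∃[ d ] ((φ : Formula B) →
         count F (acc G (neg φ)) ≡ c + d * count F (acc G φ)))
    × ((□ : B) → ∃[ c ] ∃[ d₁ ] ∃[ d₂ ] ((φ₁ φ₂ : Formula B) →
         count F (acc G (bin □ φ₁ φ₂))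
           ≡ c + d₁ * count F (acc G φ₁) + d₂ * count F (acc G φ₂)))
lemma2 F G =
    (λ i → count F (φvar i) , refl)
  , (let open CountAffine₁ (countAffine₁-subst1 F sneg ψneg)
     in c , d , λ φ → count-≡ (acc G φ))
  , λ □ → let open CountAffine₂ (countAffine₂-subst2 F (s₁ □) (s₂ □) (ψbin □))
          in c , d₁ , d₂ , λ φ₁ φ₂ → count-≡ (acc G φ₁) (acc G φ₂)
  where open AcceptableParams G
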